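{- Fix $2\le i\le k$ and fix the parts $P_{i+1},\dots,P_k$ (consecutive subpaths covering $\{x_{r_i+1},\dots,x_n\}$ for some fixed $r_i$). For each admissible left end $x_l$ of the $i$-th part $P_i=\{x_l,\dots,x_{r_i}\}$, let $F(l)$ be the minimum of $\max_{1\le j\le k}R_{l_jr_j}$ over all choices of parts $P_1,\dots,P_{i-1}$ partitioning $\{x_0,\dots,x_{l-1}\}$ into consecutive subpaths (where $P_j=\{x_{l_j},\dots,x_{r_j}\}$). Then $F$ is unimodal in $l$ with a unique minimum value.
   Context: $P$ is a path with vertices at coordinates $x_0<\dots<x_n$; $\tau>0$; $k\ge1$ fixed. Vertex $x_i$ has weight interval $[w_i^-,w_i^+]$, $0<w_i^-\le w_i^+$; a scenario $s$ assigns $w_i(s)\in[w_i^-,w_i^+]$, $\mathcal S$ the set of scenarios. For a subpath $Q=\{x_l,\dots,x_r\}$ and sink $y=x_t\in Q$: $\Theta_L(Q,y,s)=\max_{l\le i<t}\{(x_t-x_i)\tau+\sum_{j=l}^i w_j(s)\}$, $\Theta_R(Q,y,s)=\max_{t<i\le r}\{(x_i-x_t)\tau+\sum_{j=i}^r w_j(s)\}$ (empty maxima $0$), $\Theta^1=\max(\Theta_L,\Theta_R)$. A $k$-partition with sinks: consecutive subpaths $P_1,\dots,P_k$ partitioning the vertices with sinks $y_i\in P_i$; $\Theta^k=\max_i\Theta^1(P_i,y_i,s)$, $\Theta^k_{\rm opt}(P,s)$ its minimum; regret $=\Theta^k-\Theta^k_{\rm opt}$; a worst-case scenario maximizes regret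 over $\mathcal S$; dominant part $P_d$, $d$ the smallest index maximizing $\Theta^1(P_i,y_i,s)$. Left-/right-dominant sub-scenario on $\{x_l,\dots,x_r\}$: for some $l\le i\le r$, $w_j=w_j^+$ (resp. $w_j^-$) for $l\le j<i$ and $w_j=w_j^-$ (resp. $w_j^+$) for $i\le j\le r$. $\mathcal S^*$: all scenarios that, for some $k$-partition with sinks, are worst-case scenarios for it with $w_i=w_i^-$ off the dominant part and left- or right-dominant sub-scenario in it. For $Q_{lr}=\{x_l,\dots,x_r\}$: $R_{lr}(s,x_t)=\Theta^1(Q_{lr},x_t,s)-\Theta^k_{\rm opt}(P,s)$, $R_{lr}(x_t)=\max_{s\in\mathcal S^*}R_{lr}(s,x_t)$, $R_{lr}=\min_{l\le t\le r}R_{lr}(x_t)$. A function $f$ on integers is unimodal with a unique minimum value if there is $m$ such that $f$ is monotonically non-increasing for arguments $\le m$ and monotonically non-decreasing for arguments $\ge m$.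
   Formalization: The vertex coordinates, the parameter τ, the weight bounds $[w_i^-,w_i^+]$ and all scenario weights are rational. -}

module Defs where

open import Data.Nat as ℕ using (ℕ; zero; suc; _∸_)
open import Data.Rational as ℚ using (ℚ; 0ℚ)
open import Data.List using (List; []; _∷_; map; foldr; upTo; length; _++_)
open import Data.List.Relation.Unary.All using (All)
open import Data.Product using (_×_; _,_; Σ; ∃; ∃-syntax; proj₁; proj₂)
open import Data.Sum using (_⊎_)
open import Relation.Binary.PropositionalEquality using (_≡_)

-- vertices are indexed by natural numbers 0..n; functions ℕ → ℚ are only
-- consulted on 0..n.

range : ℕ → ℕ → List ℕ
range a m = map (a ℕ.+_) (upTo m)

maxList : List ℚ → ℚ
maxList = foldr ℚ._⊔_ 0ℚ

sumLen : (ℕ → ℚ) → ℕ → ℕ → ℚ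
sumLen s l zero = 0ℚ
sumLen s l (suc m) = s l ℚ.+ sumLen s (suc l) m

sumRange : (ℕ → ℚ) → ℕ → ℕ → ℚ
sumRange s l i = sumLen s l (suc i ∸ l)

minFrom : (ℕ → ℚ) → ℕ → ℕ → ℚ
minFrom f a zero = f a
minFrom f a (suc m) = f a ℚ.⊓ minFrom f (suc a) m

-- Chain a e ps : the intervals (l , r) in ps are nonempty consecutive
-- subpaths partitioning {x_a, ..., x_{e-1}}
Chain : ℕ → ℕ → List (ℕ × ℕ) → Set
Chain a e [] = a ≡ e
Chain a e ((l , r) ∷ ps) = (l ≡ a) × (l ℕ.≤ r) × Chain (suc r) e ps

-- a part with a sink: (l , r , t) means the subpath {x_l..x_r} with sink x_t
Part : Set
Part = ℕ × ℕ × ℕ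

interval : Part → ℕ × ℕ
interval (l , r , t) = (l , r)

SinkOK : Part → Set
SinkOK (l , r , t) = (l ℕ.≤ t) × (t ℕ.≤ r)

module Problem (n k : ℕ) (x : ℕ → ℚ) (τ : ℚ) (wm wp : ℕ → ℚ) where

  Scenario : (ℕ → ℚ) → Set
  Scenario s = ∀ j → j ℕ.≤ n → (wm j ℚ.≤ s j) × (s j ℚ.≤ wp j)

  -- Θ_L(Q_{lr}, x_t, s) (does not depend on r)
  ΘL : ℕ → ℕ → ℕ → (ℕ → ℚ) → ℚ
  ΘL l r t s = maxList (map (λ i → ((x t ℚ.- x i) ℚ.* τ) ℚ.+ sumRange s l i)
                            (range l (t ∸ l)))

  ΘR : ℕ → ℕ → ℕ → (ℕ → ℚ) → ℚ
  ΘR l r t s = maxList (map (λ i → ((x i ℚ.- x t) ℚ.* τ) ℚ.+ sumRange s i r)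
                            (range (suc t) (r ∸ t)))

  Θ1 : ℕ → ℕ → ℕ → (ℕ → ℚ) → ℚ
  Θ1 l r t s = ΘL l r t s ℚ.⊔ ΘR l r t s

  Θ1P : Part → (ℕ → ℚ) → ℚ
  Θ1P (l , r , t) s = Θ1 l r t s

  KPartition : List Part → Set
  KPartition π = (length π ≡ k) × Chain 0 (suc n) (map interval π) × All SinkOK π

  Θk : List Part → (ℕ → ℚ) → ℚ
  Θk π s = maxList (map (λ p → Θ1P p s) π)

  IsOpt : (ℕ → ℚ) → ℚ → Set
  IsOpt s v = (∃[ π ] (KPartition π × Θk π s ≡ v))
            × (∀ π → KPartition π → v ℚ.≤ Θk π s)

  WorstCase : List Part → (ℕ → ℚ) → Set
  WorstCase π s = Scenario s ×
    (∀ s' v v' → Scenario s' → IsOpt s v → IsOpt s' v' →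
       (Θk π s' ℚ.- v') ℚ.≤ (Θk π s ℚ.- v))

  Dominant : List Part → (ℕ → ℚ) → Part → Set
  Dominant π s p = ∃[ pre ] ∃[ suf ] ((π ≡ pre ++ (p ∷ suf))
                   × (Θ1P p s ≡ Θk π s)
                   × All (λ q → Θ1P q s ℚ.< Θk π s) pre)

  LeftDominant : ℕ → ℕ → (ℕ → ℚ) → Set
  LeftDominant l r s = ∃[ i ] ((l ℕ.≤ i) × (i ℕ.≤ r) ×
    (∀ j → l ℕ.≤ j → j ℕ.< i → s j ≡ wp j) ×
    (∀ j → i ℕ.≤ j → j ℕ.≤ r → s j ≡ wm j))

  RightDominant : ℕ → ℕ → (ℕ → ℚ) → Set
  RightDominant l r s = ∃[ i ] ((l ℕ.≤ i) × (i ℕ.≤ r) ×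
    (∀ j → l ℕ.≤ j → j ℕ.< i → s j ≡ wm j) ×
    (∀ j → i ℕ.≤ j → j ℕ.≤ r → s j ≡ wp j))

  InSstar : (ℕ → ℚ) → Set
  InSstar s = ∃[ π ] ∃[ l ] ∃[ r ] ∃[ t ] (KPartition π × WorstCase π s
    × Dominant π s (l , r , t)
    × (∀ j → j ℕ.≤ n → (j ℕ.< l ⊎ r ℕ.< j) → s j ≡ wm j)
    × (LeftDominant l r s ⊎ RightDominant l r s))

  Rs : ℕ → ℕ → ℕ → (ℕ → ℚ) → ℚ → ℚ
  Rs l r t s v = Θ1 l r t s ℚ.- v

  RSpec : (ℕ → ℕ → ℕ → ℚ) → Set
  RSpec Rv = ∀ l r t → l ℕ.≤ t → t ℕ.≤ r → r ℕ.≤ n →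
      (∃[ s ] ∃[ v ] (InSstar s × IsOpt s v × Rs l r t s v ≡ Rv l r t))
    × (∀ s v → InSstar s → IsOpt s v → Rs l r t s v ℚ.≤ Rv l r t)

  Rlr : (ℕ → ℕ → ℕ → ℚ) → ℕ → ℕ → ℚ
  Rlr Rv l r = minFrom (Rv l r) l (r ∸ l)

  cost : (ℕ → ℕ → ℕ → ℚ) → List (ℕ × ℕ) → ℕ → ℕ → List (ℕ × ℕ) → ℚ
  cost Rv pre l rᵢ tail =
    foldr ℚ._⊔_ (Rlr Rv l rᵢ) (map (λ q → Rlr Rv (proj₁ q) (proj₂ q)) (pre ++ tail))

  FSpec : (ℕ → ℕ → ℕ → ℚ) → ℕ → ℕ → List (ℕ × ℕ) → (ℕ → ℚ) → Set
  FSpec Rv i rᵢ tail F = ∀ l → (i ∸ 1) ℕ.≤ l → l ℕ.≤ rᵢ →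
      (∃[ pre ] (length pre ≡ i ∸ 1 × Chain 0 l pre × cost Rv pre l rᵢ tail ≡ F l))
    × (∀ pre → length pre ≡ i ∸ 1 → Chain 0 l pre → F l ℚ.≤ cost Rv pre l rᵢ tail)

UnimodalOn : ℕ → ℕ → (ℕ → ℚ) → Set
UnimodalOn lo hi F = ∃[ m ] ((lo ℕ.≤ m) × (m ℕ.≤ hi) ×
    (∀ a b → lo ℕ.≤ a → a ℕ.≤ b → b ℕ.≤ m → F b ℚ.≤ F a) ×
    (∀ a b → m ℕ.≤ a → a ℕ.≤ b → b ℕ.≤ hi → F a ℚ.≤ F b))

{-# OPTIONS --safe #-}
-- Write R(l) for R_{l rᵢ}, the regret term of the i-th part. Shrinking a subpath never
-- increases R_{lr}: with the sink moved to the nearest vertex of the smaller subpath, Θ¹ only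
-- loses vertices and distances, so it decreases in every nonnegative scenario, hence so do the
-- maxima R_{lr}(x_t) over 𝒮* and their minimum over t. Thus R(b) ≤ R(a) ≤ F(a) for a ≤ b.
-- For b ≤ c, an optimal partition of {x_0..x_{c-1}} into i-1 parts can be cut down to a
-- partition of {x_0..x_{b-1}} into i-1 parts each contained in an old one, so
-- F(b) ≤ max(F(c), R(b)). Hence F(b) ≤ max(F(a), F(c)) whenever a ≤ b ≤ c: F has no strict
-- interior peak, and on a finite interval this makes F monotone on both sides of any minimiser.

module Submission where

open import Defs
open import Data.Nat as ℕ using (ℕ; zero; suc; _∸_; s≤s)
import Data.Nat.Properties as ℕP
open import Data.Rational as ℚ using (ℚ; 0ℚ)
import Data.Rational.Properties as ℚP
open import Data.List using (List; []; _∷_; length; map; foldr; _++_)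
open import Data.List.Properties using (foldr-preservesʳ; foldr-preservesᵒ; foldr-preservesᵇ)
open import Data.List.Membership.Propositional using (_∈_; find)
import Data.List.Membership.Propositional.Properties as ∈
open import Data.List.Relation.Unary.Any as Any using (Any; here; there)
open import Data.List.Relation.Unary.All as All using (All; []; _∷_)
open import Data.Product using (∃-syntax; _×_; _,_; proj₁; proj₂)
open import Data.Sum using (_⊎_; inj₁; inj₂; [_,_])
open import Relation.Binary.PropositionalEquality using (_≡_; refl; sym; trans; cong; subst; module ≡-Reasoning)
open import Relation.Nullary using (yes; no)
open import Data.Empty using (⊥-elim)

init≤foldr-⊔ : ∀ e xs → e ℚ.≤ foldr ℚ._⊔_ e xs
init≤foldr-⊔ e = foldr-preservesʳ {P = e ℚ.≤_} (λ v → ℚP.p≤q⇒p≤r⊔q v) ℚP.≤-refl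

∈⇒≤foldr-⊔ : ∀ {v} e {xs} → v ∈ xs → v ℚ.≤ foldr ℚ._⊔_ e xs
∈⇒≤foldr-⊔ {v} e {xs} v∈xs = foldr-preservesᵒ {P = v ℚ.≤_}
  (λ p q → [ ℚP.p≤q⇒p≤q⊔r q , ℚP.p≤q⇒p≤r⊔q p ]) e xs (inj₂ (Any.map ℚP.≤-reflexive v∈xs))

foldr-⊔-lub : ∀ {e X} xs → e ℚ.≤ X → (∀ {v} → v ∈ xs → v ℚ.≤ X) → foldr ℚ._⊔_ e xs ℚ.≤ X
foldr-⊔-lub xs e≤X xs≤X = foldr-preservesᵇ ℚP.⊔-lub e≤X (All.tabulate xs≤X)

maxList-map-mono : ∀ {A : Set} (f g : A → ℚ) {xs ys : List A} →
  (∀ {i} → i ∈ xs → i ∈ ys × f i ℚ.≤ g i) → maxList (map f xs) ℚ.≤ maxList (map g ys)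
maxList-map-mono f g {xs} {ys} dominated = foldr-⊔-lub (map f xs) (init≤foldr-⊔ 0ℚ (map g ys)) bound
  where
  bound : ∀ {v} → v ∈ map f xs → v ℚ.≤ maxList (map g ys)
  bound v∈ with i , i∈xs , refl ← ∈.∈-map⁻ f v∈ =
    ℚP.≤-trans (proj₂ (dominated i∈xs)) (∈⇒≤foldr-⊔ 0ℚ (∈.∈-map⁺ g (proj₁ (dominated i∈xs))))

∈-range⁻ : ∀ {a b i} → i ∈ range a (b ∸ a) → a ℕ.≤ i × i ℕ.< b
∈-range⁻ {a} {b} i∈ with k , k∈ , refl ← ∈.∈-map⁻ (a ℕ.+_) i∈ = ℕP.m≤m+n a k , a+k<b
  where
  k<b∸a : k ℕ.< b ∸ a
  k<b∸a = ∈.∈-upTo⁻ k∈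
  a≤b : a ℕ.≤ b
  a≤b = ℕP.<⇒≤ (ℕP.m∸n≢0⇒n<m (λ b∸a≡0 → ℕP.n≮0 (subst (k ℕ.<_) b∸a≡0 k<b∸a)))
  a+k<b : a ℕ.+ k ℕ.< b
  a+k<b = subst (ℕ._≤ b) (cong suc (ℕP.+-comm k a)) (ℕP.m≤o∸n⇒m+n≤o (suc k) a≤b k<b∸a)

∈-range⁺ : ∀ {a b i} → a ℕ.≤ i → i ℕ.< b → i ∈ range a (b ∸ a)
∈-range⁺ {a} {b} a≤i i<b = subst (_∈ range a (b ∸ a)) (ℕP.m+[n∸m]≡n a≤i)
  (∈.∈-map⁺ (a ℕ.+_) (∈.∈-upTo⁺ (ℕP.∸-monoˡ-< i<b a≤i)))

minFrom-≤ : ∀ f {lo hi j} → lo ℕ.≤ j → j ℕ.≤ hi → minFrom f lo (hi ∸ lo) ℚ.≤ f j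
minFrom-≤ f {lo} {hi} {j} lo≤j j≤hi =
  go lo (hi ∸ lo) lo≤j (subst (j ℕ.≤_) (sym (ℕP.m+[n∸m]≡n (ℕP.≤-trans lo≤j j≤hi))) j≤hi)
  where
  go : ∀ a m → a ℕ.≤ j → j ℕ.≤ a ℕ.+ m → minFrom f a m ℚ.≤ f j
  go a zero a≤j j≤a+0 = ℚP.≤-reflexive (cong f (ℕP.≤-antisym a≤j (subst (j ℕ.≤_) (ℕP.+-identityʳ a) j≤a+0)))
  go a (suc m) a≤j j≤a+1+m with ℕP.m≤n⇒m<n∨m≡n a≤j
  ... | inj₂ refl = ℚP.p⊓q≤p _ _
  ... | inj₁ a<j = ℚP.≤-trans (ℚP.p⊓q≤q (f a) _) (go (suc a) m a<j (subst (j ℕ.≤_) (ℕP.+-suc a m) j≤a+1+m))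

minFrom-attained : ∀ f {lo hi} → lo ℕ.≤ hi →
  ∃[ j ] (lo ℕ.≤ j × j ℕ.≤ hi × minFrom f lo (hi ∸ lo) ≡ f j)
minFrom-attained f {lo} {hi} lo≤hi =
  let j , lo≤j , j≤lo+[hi∸lo] , eq = go lo (hi ∸ lo)
  in j , lo≤j , subst (j ℕ.≤_) (ℕP.m+[n∸m]≡n lo≤hi) j≤lo+[hi∸lo] , eq
  where
  go : ∀ a m → ∃[ j ] (a ℕ.≤ j × j ℕ.≤ a ℕ.+ m × minFrom f a m ≡ f j)
  go a zero = a , ℕP.≤-refl , ℕP.m≤m+n a 0 , refl
  go a (suc m) with ℚP.⊓-sel (f a) (minFrom f (suc a) m) | go (suc a) m
  ... | inj₁ eq | _ = a , ℕP.≤-refl , ℕP.m≤m+n a _ , eq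
  ... | inj₂ eq | j , a<j , j≤ , eq′ = j , ℕP.<⇒≤ a<j , subst (j ℕ.≤_) (sym (ℕP.+-suc a m)) j≤ , trans eq eq′

NoPeakOn : ℕ → ℕ → (ℕ → ℚ) → Set
NoPeakOn lo hi F = ∀ a b c → lo ℕ.≤ a → a ℕ.≤ b → b ℕ.≤ c → c ℕ.≤ hi → F b ℚ.≤ F a ℚ.⊔ F c

noPeak⇒unimodal : ∀ {lo hi F} → lo ℕ.≤ hi → NoPeakOn lo hi F → UnimodalOn lo hi F
noPeak⇒unimodal {lo} {hi} {F} lo≤hi noPeak with m , lo≤m , m≤hi , min≡Fm ← minFrom-attained F lo≤hi =
  m , lo≤m , m≤hi , nonIncreasing , nonDecreasing
  where
  Fm≤ : ∀ {j} → lo ℕ.≤ j → j ℕ.≤ hi → F m ℚ.≤ F j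
  Fm≤ lo≤j j≤hi = subst (ℚ._≤ F _) min≡Fm (minFrom-≤ F lo≤j j≤hi)
  nonIncreasing : ∀ a b → lo ℕ.≤ a → a ℕ.≤ b → b ℕ.≤ m → F b ℚ.≤ F a
  nonIncreasing a b lo≤a a≤b b≤m = ℚP.≤-trans (noPeak a b m lo≤a a≤b b≤m m≤hi)
    (ℚP.⊔-lub ℚP.≤-refl (Fm≤ lo≤a (ℕP.≤-trans a≤b (ℕP.≤-trans b≤m m≤hi))))
  nonDecreasing : ∀ a b → m ℕ.≤ a → a ℕ.≤ b → b ℕ.≤ hi → F a ℚ.≤ F b
  nonDecreasing a b m≤a a≤b b≤hi = ℚP.≤-trans (noPeak m a b lo≤m m≤a a≤b b≤hi)
    (ℚP.⊔-lub (Fm≤ (ℕP.≤-trans lo≤m (ℕP.≤-trans m≤a a≤b)) b≤hi) ℚP.≤-refl)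

∸-split : ∀ {l m e} → l ℕ.≤ m → m ℕ.≤ e → e ∸ l ≡ (m ∸ l) ℕ.+ (e ∸ m)
∸-split {l} {m} {e} l≤m m≤e = begin
  e ∸ l                  ≡⟨ cong (_∸ l) (sym (ℕP.m+[n∸m]≡n m≤e)) ⟩
  (m ℕ.+ (e ∸ m)) ∸ l    ≡⟨ ℕP.+-∸-comm (e ∸ m) l≤m ⟩
  (m ∸ l) ℕ.+ (e ∸ m)    ∎
  where open ≡-Reasoning

p≤q+p : ∀ {p q} → 0ℚ ℚ.≤ q → p ℚ.≤ q ℚ.+ p
p≤q+p {p} {q} 0≤q = subst (ℚ._≤ q ℚ.+ p) (ℚP.+-identityˡ p) (ℚP.+-monoˡ-≤ p 0≤q)

p≤p+q : ∀ {p q} → 0ℚ ℚ.≤ q → p ℚ.≤ p ℚ.+ q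
p≤p+q {p} {q} 0≤q = subst (ℚ._≤ p ℚ.+ q) (ℚP.+-identityʳ p) (ℚP.+-monoʳ-≤ p 0≤q)

module _ (s : ℕ → ℚ) where

  sumLen-+ : ∀ l m d → sumLen s l (m ℕ.+ d) ≡ sumLen s l m ℚ.+ sumLen s (l ℕ.+ m) d
  sumLen-+ l zero d = sym (begin
    0ℚ ℚ.+ sumLen s (l ℕ.+ 0) d  ≡⟨ ℚP.+-identityˡ _ ⟩
    sumLen s (l ℕ.+ 0) d         ≡⟨ cong (λ a → sumLen s a d) (ℕP.+-identityʳ l) ⟩
    sumLen s l d                 ∎)
    where open ≡-Reasoning
  sumLen-+ l (suc m) d = begin
    s l ℚ.+ sumLen s (suc l) (m ℕ.+ d)                          ≡⟨ cong (s l ℚ.+_) (sumLen-+ (suc l) m d) ⟩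
    s l ℚ.+ (sumLen s (suc l) m ℚ.+ sumLen s (suc l ℕ.+ m) d)   ≡⟨ sym (ℚP.+-assoc (s l) _ _) ⟩
    sumLen s l (suc m) ℚ.+ sumLen s (suc l ℕ.+ m) d             ≡⟨ cong (λ a → sumLen s l (suc m) ℚ.+ sumLen s a d) (sym (ℕP.+-suc l m)) ⟩
    sumLen s l (suc m) ℚ.+ sumLen s (l ℕ.+ suc m) d             ∎
    where open ≡-Reasoning

  sumRange-split : ∀ {l m i} → l ℕ.≤ m → m ℕ.≤ suc i →
    sumRange s l i ≡ sumLen s l (m ∸ l) ℚ.+ sumLen s m (suc i ∸ m)
  sumRange-split {l} {m} {i} l≤m m≤1+i = begin
    sumLen s l (suc i ∸ l)                                         ≡⟨ cong (sumLen s l) (∸-split l≤m m≤1+i) ⟩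
    sumLen s l ((m ∸ l) ℕ.+ (suc i ∸ m))                           ≡⟨ sumLen-+ l (m ∸ l) (suc i ∸ m) ⟩
    sumLen s l (m ∸ l) ℚ.+ sumLen s (l ℕ.+ (m ∸ l)) (suc i ∸ m)    ≡⟨ cong (λ a → sumLen s l (m ∸ l) ℚ.+ sumLen s a (suc i ∸ m)) (ℕP.m+[n∸m]≡n l≤m) ⟩
    sumLen s l (m ∸ l) ℚ.+ sumLen s m (suc i ∸ m)                  ∎
    where open ≡-Reasoning

  module _ {n} (s≥0 : ∀ j → j ℕ.≤ n → 0ℚ ℚ.≤ s j) where

    sumLen-nonNeg : ∀ l m → l ℕ.+ m ℕ.≤ suc n → 0ℚ ℚ.≤ sumLen s l m
    sumLen-nonNeg l zero _ = ℚP.≤-refl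
    sumLen-nonNeg l (suc m) l+1+m≤1+n = ℚP.+-mono-≤ (s≥0 l l≤n) (sumLen-nonNeg (suc l) m 1+l+m≤1+n)
      where
      1+l+m≤1+n : suc l ℕ.+ m ℕ.≤ suc n
      1+l+m≤1+n = subst (ℕ._≤ suc n) (ℕP.+-suc l m) l+1+m≤1+n
      l≤n : l ℕ.≤ n
      l≤n = ℕP.≤-trans (ℕP.m≤m+n l m) (ℕP.≤-pred 1+l+m≤1+n)

    sumRange-antitoneˡ : ∀ {l l' i} → l ℕ.≤ l' → l' ℕ.≤ suc i → i ℕ.≤ n → sumRange s l' i ℚ.≤ sumRange s l i
    sumRange-antitoneˡ {l} {l'} {i} l≤l' l'≤1+i i≤n =
      subst (sumRange s l' i ℚ.≤_) (sym (sumRange-split l≤l' l'≤1+i)) (p≤q+p (sumLen-nonNeg l (l' ∸ l) l+[l'∸l]≤1+n))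
      where
      l+[l'∸l]≤1+n : l ℕ.+ (l' ∸ l) ℕ.≤ suc n
      l+[l'∸l]≤1+n = subst (ℕ._≤ suc n) (sym (ℕP.m+[n∸m]≡n l≤l')) (ℕP.≤-trans l'≤1+i (s≤s i≤n))

    sumRange-monoʳ : ∀ {i r' r} → i ℕ.≤ suc r' → r' ℕ.≤ r → r ℕ.≤ n → sumRange s i r' ℚ.≤ sumRange s i r
    sumRange-monoʳ {i} {r'} {r} i≤1+r' r'≤r r≤n =
      subst (sumRange s i r' ℚ.≤_) (sym (sumRange-split i≤1+r' (s≤s r'≤r))) (p≤p+q (sumLen-nonNeg (suc r') (r ∸ r') 1+r'+[r∸r']≤1+n))
      where
      1+r'+[r∸r']≤1+n : suc r' ℕ.+ (r ∸ r') ℕ.≤ suc n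
      1+r'+[r∸r']≤1+n = subst (ℕ._≤ suc n) (sym (cong suc (ℕP.m+[n∸m]≡n r'≤r))) (s≤s r≤n)

_⊆ᵢ_ : ℕ × ℕ → ℕ × ℕ → Set
q ⊆ᵢ p = proj₁ p ℕ.≤ proj₁ q × proj₂ q ℕ.≤ proj₂ p

Refines : List (ℕ × ℕ) → List (ℕ × ℕ) → Set
Refines qs ps = All (λ q → Any (q ⊆ᵢ_) ps) qs

chain-≤ : ∀ {a e ps} → Chain a e ps → a ℕ.≤ e
chain-≤ {ps = []} refl = ℕP.≤-refl
chain-≤ {ps = _ ∷ _} (refl , l≤r , ch) = ℕP.≤-trans l≤r (ℕP.<⇒≤ (chain-≤ ch))

chain-nonEmpty : ∀ {a e ps} → Chain a e ps → All (λ p → proj₁ p ℕ.≤ proj₂ p) ps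
chain-nonEmpty {ps = []} _ = []
chain-nonEmpty {ps = _ ∷ _} (_ , l≤r , ch) = l≤r ∷ chain-nonEmpty ch

chain-bounded : ∀ {a e ps} → Chain a e ps → All (λ p → proj₂ p ℕ.< e) ps
chain-bounded {ps = []} _ = []
chain-bounded {ps = _ ∷ _} (_ , _ , ch) = chain-≤ ch ∷ chain-bounded ch

chain-cover : ∀ {a e ps j} → Chain a e ps → a ℕ.≤ j → j ℕ.< e → Any ((j , j) ⊆ᵢ_) ps
chain-cover {ps = []} refl a≤j j<a = ⊥-elim (ℕP.<-irrefl refl (ℕP.≤-<-trans a≤j j<a))
chain-cover {ps = (_ , r) ∷ _} {j} (refl , _ , ch) a≤j j<e with j ℕ.≤? r
... | yes j≤r = here (a≤j , j≤r)
... | no j≰r = there (chain-cover ch (ℕP.≰⇒> j≰r) j<e)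

singletons : ℕ → ℕ → List (ℕ × ℕ)
singletons c zero = []
singletons c (suc m) = (c , c) ∷ singletons (suc c) m

length-singletons : ∀ c m → length (singletons c m) ≡ m
length-singletons c zero = refl
length-singletons c (suc m) = cong suc (length-singletons (suc c) m)

singletons-chain : ∀ c m → Chain c (c ℕ.+ m) (singletons c m)
singletons-chain c zero = sym (ℕP.+-identityʳ c)
singletons-chain c (suc m) =
  refl , ℕP.≤-refl , subst (λ e → Chain (suc c) e (singletons (suc c) m)) (sym (ℕP.+-suc c m)) (singletons-chain (suc c) m)

singletons-refine : ∀ {a e ps} c m → Chain a e ps → a ℕ.≤ c → c ℕ.+ m ℕ.≤ e → Refines (singletons c m) ps
singletons-refine c zero ch a≤c c+m≤e = []
singletons-refine {e = e} c (suc m) ch a≤c c+1+m≤e =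
  chain-cover ch a≤c (ℕP.<-≤-trans (ℕP.m<m+n c ℕ.z<s) c+1+m≤e) ∷
  singletons-refine (suc c) m ch (ℕP.m≤n⇒m≤1+n a≤c) (subst (ℕ._≤ e) (ℕP.+-suc c m) c+1+m≤e)

-- Keep the leading parts while the remaining ones still fit, then cut the current part short
-- and fill up with singletons.
chain-truncate : ∀ m {a b e ps} → Chain a e ps → length ps ≡ m → a ℕ.+ m ℕ.≤ b → b ℕ.≤ e →
  ∃[ qs ] (length qs ≡ m × Chain a b qs × Refines qs ps)
chain-truncate zero {a} {ps = []} refl refl a+0≤b b≤a =
  [] , refl , ℕP.≤-antisym (subst (ℕ._≤ _) (ℕP.+-identityʳ a) a+0≤b) b≤a , []
chain-truncate (suc m) {a} {b} {e} {(_ , r) ∷ ps} ch@(refl , a≤r , ch′) |ps|≡1+m a+1+m≤b b≤e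
  with suc r ℕ.+ m ℕ.≤? b
... | yes fits =
  let qs , |qs|≡m , qs-chain , qs-refine = chain-truncate m ch′ (ℕP.suc-injective |ps|≡1+m) fits b≤e
  in (a , r) ∷ qs , cong suc |qs|≡m , (refl , a≤r , qs-chain) , here (ℕP.≤-refl , ℕP.≤-refl) ∷ All.map there qs-refine
... | no overflows =
  (a , r″) ∷ singletons (suc r″) m , cong suc (length-singletons (suc r″) m) ,
  (refl , a≤r″ , subst (λ e′ → Chain (suc r″) e′ (singletons (suc r″) m)) 1+r″+m≡b (singletons-chain (suc r″) m)) ,
  here (ℕP.≤-refl , r″≤r) ∷ singletons-refine (suc r″) m ch (ℕP.m≤n⇒m≤1+n a≤r″) (ℕP.≤-trans (ℕP.≤-reflexive 1+r″+m≡b) b≤e)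
  where
  r″ = b ∸ suc m
  1+r″+m≡b : suc r″ ℕ.+ m ≡ b
  1+r″+m≡b = trans (sym (ℕP.+-suc r″ m)) (ℕP.m∸n+n≡m (ℕP.≤-trans (ℕP.m≤n+m (suc m) a) a+1+m≤b))
  a≤r″ : a ℕ.≤ r″
  a≤r″ = ℕP.m+n≤o⇒m≤o∸n a a+1+m≤b
  b≤1+m+r : b ℕ.≤ suc m ℕ.+ r
  b≤1+m+r = ℕP.≤-trans (ℕP.≤-pred (ℕP.≰⇒> overflows)) (ℕP.≤-trans (ℕP.≤-reflexive (ℕP.+-comm r m)) (ℕP.n≤1+n (m ℕ.+ r)))
  r″≤r : r″ ℕ.≤ r
  r″≤r = ℕP.m≤n+o⇒m∸n≤o b (suc m) b≤1+m+r

module Regret (n k : ℕ) (x : ℕ → ℚ) (τ : ℚ) (wm wp : ℕ → ℚ)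
  (x-mono : ∀ {a b} → a ℕ.≤ b → b ℕ.≤ n → x a ℚ.≤ x b) (τ≥0 : 0ℚ ℚ.≤ τ) where

  open Problem n k x τ wm wp

  NonNegUpTo : (ℕ → ℚ) → Set
  NonNegUpTo s = ∀ j → j ℕ.≤ n → 0ℚ ℚ.≤ s j

  private instance
    τ-nonNeg : ℚ.NonNegative τ
    τ-nonNeg = ℚ.nonNegative τ≥0

  scaledGap-mono : ∀ {a a' b b'} → a ℚ.≤ a' → b' ℚ.≤ b → (a ℚ.- b) ℚ.* τ ℚ.≤ (a' ℚ.- b') ℚ.* τ
  scaledGap-mono a≤a' b'≤b = ℚP.*-monoʳ-≤-nonNeg τ (ℚP.+-mono-≤ a≤a' (ℚP.neg-antimono-≤ b'≤b))

  0≤ΘL : ∀ l r t s → 0ℚ ℚ.≤ ΘL l r t s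
  0≤ΘL l r t s = init≤foldr-⊔ 0ℚ (map _ (range l (t ∸ l)))

  0≤ΘR : ∀ l r t s → 0ℚ ℚ.≤ ΘR l r t s
  0≤ΘR l r t s = init≤foldr-⊔ 0ℚ (map _ (range (suc t) (r ∸ t)))

  ΘL-sinkAtLeft : ∀ l r s → ΘL l r l s ℚ.≤ 0ℚ
  ΘL-sinkAtLeft l r s = maxList-map-mono _ (λ _ → 0ℚ) {ys = []} λ i∈ →
    let l≤i , i<l = ∈-range⁻ {l} {l} i∈ in ⊥-elim (ℕP.<-irrefl refl (ℕP.≤-<-trans l≤i i<l))

  ΘR-sinkAtRight : ∀ l r s → ΘR l r r s ℚ.≤ 0ℚ
  ΘR-sinkAtRight l r s = maxList-map-mono _ (λ _ → 0ℚ) {ys = []} λ i∈ →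
    let r<i , i≤r = ∈-range⁻ {suc r} {suc r} i∈ in ⊥-elim (ℕP.<-irrefl refl (ℕP.≤-<-trans r<i i≤r))

  module _ {s} (s≥0 : NonNegUpTo s) where

    ΘL-mono : ∀ {l l' r r' t t'} → l ℕ.≤ l' → t' ℕ.≤ t → t ℕ.≤ n → ΘL l' r' t' s ℚ.≤ ΘL l r t s
    ΘL-mono {l} {l'} {r} {r'} {t} {t'} l≤l' t'≤t t≤n = maxList-map-mono _ _ λ i∈ →
      let l'≤i , i<t' = ∈-range⁻ {l'} {t'} i∈
          i<t = ℕP.<-≤-trans i<t' t'≤t
      in ∈-range⁺ (ℕP.≤-trans l≤l' l'≤i) i<t ,
         ℚP.+-mono-≤ (scaledGap-mono (x-mono t'≤t t≤n) ℚP.≤-refl)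
                     (sumRange-antitoneˡ s s≥0 l≤l' (ℕP.m≤n⇒m≤1+n l'≤i) (ℕP.≤-trans (ℕP.<⇒≤ i<t) t≤n))

    ΘR-mono : ∀ {l l' r r' t t'} → t ℕ.≤ t' → r' ℕ.≤ r → r ℕ.≤ n → ΘR l' r' t' s ℚ.≤ ΘR l r t s
    ΘR-mono {l} {l'} {r} {r'} {t} {t'} t≤t' r'≤r r≤n = maxList-map-mono _ _ λ {i} i∈ →
      let t'<i , i≤r' = ∈-range⁻ {suc t'} {suc r'} i∈
          t'≤n = ℕP.≤-trans (ℕP.<⇒≤ t'<i) (ℕP.≤-trans (ℕP.≤-pred i≤r') (ℕP.≤-trans r'≤r r≤n))
      in ∈-range⁺ {suc t} {suc r} (ℕP.≤-trans (s≤s t≤t') t'<i) (ℕP.<-≤-trans i≤r' (s≤s r'≤r)) ,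
         ℚP.+-mono-≤ (scaledGap-mono (ℚP.≤-refl {x i}) (x-mono t≤t' t'≤n))
                     (sumRange-monoʳ s s≥0 (ℕP.m≤n⇒m≤1+n (ℕP.≤-pred i≤r')) r'≤r r≤n)

  Θ1-restrict : ∀ {l l' r r' t} → l ℕ.≤ l' → l' ℕ.≤ r' → r' ℕ.≤ r → r ℕ.≤ n → t ℕ.≤ r →
    ∃[ t' ] (l' ℕ.≤ t' × t' ℕ.≤ r' × (∀ s → NonNegUpTo s → Θ1 l' r' t' s ℚ.≤ Θ1 l r t s))
  Θ1-restrict {l} {l'} {r} {r'} {t} l≤l' l'≤r' r'≤r r≤n t≤r with t ℕ.<? l' | t ℕ.≤? r'
  ... | yes t<l' | _ = l' , ℕP.≤-refl , l'≤r' , λ s s≥0 → ℚP.⊔-mono-≤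
    (ℚP.≤-trans (ΘL-sinkAtLeft l' r' s) (0≤ΘL l r t s)) (ΘR-mono s≥0 {l} {l'} {t = t} (ℕP.<⇒≤ t<l') r'≤r r≤n)
  ... | no t≮l' | yes t≤r' = t , ℕP.≮⇒≥ t≮l' , t≤r' , λ s s≥0 → ℚP.⊔-mono-≤
    (ΘL-mono s≥0 {r = r} {r'} {t} l≤l' ℕP.≤-refl (ℕP.≤-trans t≤r r≤n)) (ΘR-mono s≥0 {l} {l'} {t = t} ℕP.≤-refl r'≤r r≤n)
  ... | no _ | no t≰r' = r' , l'≤r' , ℕP.≤-refl , λ s s≥0 → ℚP.⊔-mono-≤
    (ΘL-mono s≥0 {r = r} {r'} {t} l≤l' (ℕP.<⇒≤ (ℕP.≰⇒> t≰r')) (ℕP.≤-trans t≤r r≤n)) (ℚP.≤-trans (ΘR-sinkAtRight l' r' s) (0≤ΘR l r t s))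

  module _ (w-bounds : ∀ j → j ℕ.≤ n → (0ℚ ℚ.< wm j) × (wm j ℚ.≤ wp j))
           (Rv : ℕ → ℕ → ℕ → ℚ) (RS : RSpec Rv) where

    Sstar-nonNeg : ∀ {s} → InSstar s → NonNegUpTo s
    Sstar-nonNeg (_ , _ , _ , _ , _ , (scenario , _) , _) j j≤n =
      ℚP.≤-trans (ℚP.<⇒≤ (proj₁ (w-bounds j j≤n))) (proj₁ (scenario j j≤n))

    Rv-mono : ∀ {l l' r r' t t'} → l' ℕ.≤ t' → t' ℕ.≤ r' → r' ℕ.≤ n → l ℕ.≤ t → t ℕ.≤ r → r ℕ.≤ n →
      (∀ s → NonNegUpTo s → Θ1 l' r' t' s ℚ.≤ Θ1 l r t s) → Rv l' r' t' ℚ.≤ Rv l r t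
    Rv-mono {l} {l'} {r} {r'} {t} {t'} l'≤t' t'≤r' r'≤n l≤t t≤r r≤n Θ1≤Θ1 =
      let s , v , s∈S* , v-opt , Rs≡Rv = proj₁ (RS l' r' t' l'≤t' t'≤r' r'≤n) in
      begin
        Rv l' r' t'          ≡⟨ sym Rs≡Rv ⟩
        Θ1 l' r' t' s ℚ.- v  ≤⟨ ℚP.+-monoˡ-≤ (ℚ.- v) (Θ1≤Θ1 s (Sstar-nonNeg s∈S*)) ⟩
        Θ1 l r t s ℚ.- v     ≤⟨ proj₂ (RS l r t l≤t t≤r r≤n) s v s∈S* v-opt ⟩
        Rv l r t             ∎
      where open ℚP.≤-Reasoning

    Rlr-≤ : ∀ {l r t} → l ℕ.≤ t → t ℕ.≤ r → Rlr Rv l r ℚ.≤ Rv l r t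
    Rlr-≤ {l} {r} = minFrom-≤ (Rv l r)

    Rlr-mono : ∀ {l l' r r'} → l ℕ.≤ l' → l' ℕ.≤ r' → r' ℕ.≤ r → r ℕ.≤ n → Rlr Rv l' r' ℚ.≤ Rlr Rv l r
    Rlr-mono {l} {l'} {r} {r'} l≤l' l'≤r' r'≤r r≤n =
      let t , l≤t , t≤r , Rlr≡Rv = minFrom-attained (Rv l r) (ℕP.≤-trans l≤l' (ℕP.≤-trans l'≤r' r'≤r))
          t' , l'≤t' , t'≤r' , Θ1≤Θ1 = Θ1-restrict l≤l' l'≤r' r'≤r r≤n t≤r
      in begin
        Rlr Rv l' r'  ≤⟨ Rlr-≤ l'≤t' t'≤r' ⟩
        Rv l' r' t'   ≤⟨ Rv-mono l'≤t' t'≤r' (ℕP.≤-trans r'≤r r≤n) l≤t t≤r r≤n Θ1≤Θ1 ⟩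
        Rv l r t      ≡⟨ sym Rlr≡Rv ⟩
        Rlr Rv l r    ∎
      where open ℚP.≤-Reasoning

    Rlr-part : ℕ × ℕ → ℚ
    Rlr-part q = Rlr Rv (proj₁ q) (proj₂ q)

    cost-refine : ∀ {qs ps b c} rᵢ tail → Refines qs ps → All (λ q → proj₁ q ℕ.≤ proj₂ q) qs →
      All (λ p → proj₂ p ℕ.≤ n) ps → cost Rv qs b rᵢ tail ℚ.≤ cost Rv ps c rᵢ tail ℚ.⊔ Rlr Rv b rᵢ
    cost-refine {qs} {ps} {b} {c} rᵢ tail refines nonEmpty bounded =
      foldr-⊔-lub (map Rlr-part (qs ++ tail)) (ℚP.p≤q⊔p (cost Rv ps c rᵢ tail) (Rlr Rv b rᵢ)) λ v∈ →
        let q , q∈ , v≡Rq = ∈.∈-map⁻ Rlr-part v∈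
        in subst (ℚ._≤ cost Rv ps c rᵢ tail ℚ.⊔ Rlr Rv b rᵢ) (sym v≡Rq) (ℚP.p≤q⇒p≤q⊔r (Rlr Rv b rᵢ) (part≤cost q (∈.∈-++⁻ qs q∈)))
      where
      part≤cost : ∀ q → q ∈ qs ⊎ q ∈ tail → Rlr-part q ℚ.≤ cost Rv ps c rᵢ tail
      part≤cost q (inj₂ q∈tail) = ∈⇒≤foldr-⊔ _ (∈.∈-map⁺ Rlr-part (∈.∈-++⁺ʳ ps q∈tail))
      part≤cost q (inj₁ q∈qs) =
        let p , p∈ps , (p₁≤q₁ , q₂≤p₂) = find (All.lookup refines q∈qs)
        in ℚP.≤-trans (Rlr-mono p₁≤q₁ (All.lookup nonEmpty q∈qs) q₂≤p₂ (All.lookup bounded p∈ps))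
                      (∈⇒≤foldr-⊔ _ (∈.∈-map⁺ Rlr-part (∈.∈-++⁺ˡ p∈ps)))

    module _ (i rᵢ : ℕ) (tail : List (ℕ × ℕ)) (rᵢ≤n : rᵢ ℕ.≤ n) (F : ℕ → ℚ)
             (FS : FSpec Rv i rᵢ tail F) where

      Rlr≤F : ∀ {a} → i ∸ 1 ℕ.≤ a → a ℕ.≤ rᵢ → Rlr Rv a rᵢ ℚ.≤ F a
      Rlr≤F {a} i-1≤a a≤rᵢ =
        let pre , _ , _ , cost≡F = proj₁ (FS a i-1≤a a≤rᵢ)
        in subst (Rlr Rv a rᵢ ℚ.≤_) cost≡F (init≤foldr-⊔ _ (map Rlr-part (pre ++ tail)))

      F≤F⊔Rlr : ∀ {b c} → i ∸ 1 ℕ.≤ b → b ℕ.≤ c → c ℕ.≤ rᵢ → F b ℚ.≤ F c ℚ.⊔ Rlr Rv b rᵢ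
      F≤F⊔Rlr {b} {c} i-1≤b b≤c c≤rᵢ =
        let pre , |pre|≡i-1 , pre-chain , cost≡Fc = proj₁ (FS c (ℕP.≤-trans i-1≤b b≤c) c≤rᵢ)
            qs , |qs|≡i-1 , qs-chain , qs-refines = chain-truncate (i ∸ 1) pre-chain |pre|≡i-1 i-1≤b b≤c
            pre-bounded = All.map (λ r<c → ℕP.≤-trans (ℕP.<⇒≤ r<c) (ℕP.≤-trans c≤rᵢ rᵢ≤n)) (chain-bounded pre-chain)
        in begin
          F b                                   ≤⟨ proj₂ (FS b i-1≤b (ℕP.≤-trans b≤c c≤rᵢ)) qs |qs|≡i-1 qs-chain ⟩
          cost Rv qs b rᵢ tail                  ≤⟨ cost-refine {b = b} {c} rᵢ tail qs-refines (chain-nonEmpty qs-chain) pre-bounded ⟩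
          cost Rv pre c rᵢ tail ℚ.⊔ Rlr Rv b rᵢ  ≡⟨ cong (ℚ._⊔ Rlr Rv b rᵢ) cost≡Fc ⟩
          F c ℚ.⊔ Rlr Rv b rᵢ                   ∎
        where open ℚP.≤-Reasoning

      F-noPeak : NoPeakOn (i ∸ 1) rᵢ F
      F-noPeak a b c i-1≤a a≤b b≤c c≤rᵢ = begin
        F b                  ≤⟨ F≤F⊔Rlr (ℕP.≤-trans i-1≤a a≤b) b≤c c≤rᵢ ⟩
        F c ℚ.⊔ Rlr Rv b rᵢ  ≤⟨ ℚP.⊔-monoʳ-≤ (F c) Rb≤Fa ⟩
        F c ℚ.⊔ F a          ≡⟨ ℚP.⊔-comm (F c) (F a) ⟩
        F a ℚ.⊔ F c          ∎
        where
        open ℚP.≤-Reasoning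
        b≤rᵢ = ℕP.≤-trans b≤c c≤rᵢ
        Rb≤Fa : Rlr Rv b rᵢ ℚ.≤ F a
        Rb≤Fa = ℚP.≤-trans (Rlr-mono a≤b b≤rᵢ ℕP.≤-refl rᵢ≤n) (Rlr≤F i-1≤a (ℕP.≤-trans a≤b b≤rᵢ))

strictMono⇒mono : ∀ {n} (x : ℕ → ℚ) → (∀ a b → a ℕ.< b → b ℕ.≤ n → x a ℚ.< x b) →
  ∀ {a b} → a ℕ.≤ b → b ℕ.≤ n → x a ℚ.≤ x b
strictMono⇒mono x x-strict a≤b b≤n with ℕP.m≤n⇒m<n∨m≡n a≤b
... | inj₁ a<b = ℚP.<⇒≤ (x-strict _ _ a<b b≤n)
... | inj₂ refl = ℚP.≤-refl

mainTheorem10 : (n k : ℕ) (x : ℕ → ℚ) (τ : ℚ) (wm wp : ℕ → ℚ) →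
    1 ℕ.≤ k →
    (∀ a b → a ℕ.< b → b ℕ.≤ n → x a ℚ.< x b) →
    0ℚ ℚ.< τ →
    (∀ j → j ℕ.≤ n → (0ℚ ℚ.< wm j) × (wm j ℚ.≤ wp j)) →
    (i : ℕ) → 2 ℕ.≤ i → i ℕ.≤ k →
    (rᵢ : ℕ) → rᵢ ℕ.≤ n → (i ∸ 1) ℕ.≤ rᵢ →
    (tail : List (ℕ × ℕ)) → length tail ≡ k ∸ i → Chain (suc rᵢ) (suc n) tail →
    (Rv : ℕ → ℕ → ℕ → ℚ) → Problem.RSpec n k x τ wm wp Rv →
    (F : ℕ → ℚ) → Problem.FSpec n k x τ wm wp Rv i rᵢ tail F →
    UnimodalOn (i ∸ 1) rᵢ F
mainTheorem10 n k x τ wm wp _ x-strict 0<τ w-bounds i _ _ rᵢ rᵢ≤n i-1≤rᵢ tail _ _ Rv RS F FS =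
  noPeak⇒unimodal i-1≤rᵢ
    (Regret.F-noPeak n k x τ wm wp (strictMono⇒mono x x-strict) (ℚP.<⇒≤ 0<τ) w-bounds Rv RS i rᵢ tail rᵢ≤n F FS)
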